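{- Let $Q\subseteq\mathbb{F}^n$ be a linear code and let $\mathcal{T}=\mathcal{T}_1\sqcup\mathcal{T}_2$ be a collusion pattern on $[n]$ that is the disjoint union of collusion patterns $\mathcal{T}_1,\mathcal{T}_2$ whose vertex sets $V_1,V_2\subseteq[n]$ are disjoint. Let $Q_i$ denote the restriction (projection) of $Q$ to the coordinates $V_i$. Then, up to reordering coordinates, $Q^\mathcal{T}=Q_1^{\mathcal{T}_1}\times Q_2^{\mathcal{T}_2}\times\mathbb{F}^{[n]\setminus(V_1\cup V_2)}$.
   Context: A collusion pattern on $[n]$ is an abstract simplicial complex on $[n]$; its vertex set is the union of its members. The lift is $Q^\mathcal{T}=\{x\in\mathbb{F}^n : \exists y\in Q \text{ with } x|_T=y|_T \text{ for all } T\in\mathcal{T}\}$; for $Q_i$ on coordinates $V_i$, $Q_i^{\mathcal{T}_i}\subseteq\mathbb{F}^{V_i}$ is defined analogously. -}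

module Defs where

open import Level using (Level; _⊔_; suc)
open import Algebra.Bundles using (CommutativeRing)
open import Data.Nat using (ℕ)
open import Data.Fin using (Fin)
open import Data.Fin.Subset using (Subset; _∈_; _∉_; _⊆_)
open import Data.Product using (Σ; ∃; ∃-syntax; _×_; _,_; proj₁)
open import Relation.Nullary using (¬_)
open import Function.Bundles using (_⇔_)

record Field (c ℓ : Level) : Set (Level.suc (c ⊔ ℓ)) where
  field
    commutativeRing : CommutativeRing c ℓ
  open CommutativeRing commutativeRing public
  field
    0≉1     : ¬ (0# ≈ 1#)
    inverse : ∀ x → ¬ (x ≈ 0#) → ∃[ y ] (x * y ≈ 1#)

module _ {c ℓ : Level} (F : Field c ℓ) where
  open Field F

  Word : ℕ → Set c
  Word n = Fin n → Carrier

  Coord : {n : ℕ} → Subset n → Set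
  Coord {n} V = Σ (Fin n) (λ i → i ∈ V)

  WordOn : {n : ℕ} → Subset n → Set c
  WordOn V = Coord V → Carrier

  restrict : {n : ℕ} (V : Subset n) → Word n → WordOn V
  restrict V x p = x (proj₁ p)

  _≈V_ : {n : ℕ} {V : Subset n} → WordOn V → WordOn V → Set ℓ
  z ≈V w = ∀ p → z p ≈ w p

  record IsLinearCode {ℓq : Level} {n : ℕ} (Q : Word n → Set ℓq) : Set (c ⊔ ℓ ⊔ ℓq) where
    field
      respects : ∀ x y → (∀ i → x i ≈ y i) → Q x → Q y
      zero∈    : Q (λ _ → 0#)
      +-closed : ∀ x y → Q x → Q y → Q (λ i → x i + y i)
      *-closed : ∀ a x → Q x → Q (λ i → a * x i)

  Proj : {ℓq : Level} {n : ℕ} → (Word n → Set ℓq) → (V : Subset n) → WordOn V → Set (c ⊔ ℓ ⊔ ℓq)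
  Proj Q V z = ∃[ y ] (Q y × (z ≈V restrict V y))

  Lift : {ℓq ℓt : Level} {n : ℕ} → (Word n → Set ℓq) → (Subset n → Set ℓt) → Word n → Set (c ⊔ ℓ ⊔ ℓq ⊔ ℓt)
  Lift Q 𝒯 x = ∀ T → 𝒯 T → ∃[ y ] (Q y × (∀ i → i ∈ T → x i ≈ y i))

  LiftOn : {ℓp ℓt : Level} {n : ℕ} (V : Subset n) → (WordOn V → Set ℓp) → (Subset n → Set ℓt) → WordOn V → Set (c ⊔ ℓ ⊔ ℓp ⊔ ℓt)
  LiftOn V P 𝒯 z = ∀ T → 𝒯 T → ∃[ w ] (P w × (∀ (p : Coord V) → proj₁ p ∈ T → z p ≈ w p))

IsCollusionPattern : {ℓt : Level} {n : ℕ} → (Subset n → Set ℓt) → Set ℓt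
IsCollusionPattern 𝒯 = ∀ S T → 𝒯 T → S ⊆ T → 𝒯 S

IsVertexSet : {ℓt : Level} {n : ℕ} → (Subset n → Set ℓt) → Subset n → Set ℓt
IsVertexSet {n = n} 𝒯 V = ∀ (i : Fin n) → (i ∈ V) ⇔ (∃[ T ] (𝒯 T × i ∈ T))

DisjointSub : {n : ℕ} → Subset n → Subset n → Set
DisjointSub {n} V W = ∀ (i : Fin n) → i ∈ V → i ∉ W

-- The lift condition is checked one member T at a time and only reads x on T.
-- A member of 𝒯 lies in 𝒯₁ or 𝒯₂, hence inside V₁ or V₂, and a codeword of Q
-- agrees with x on T ⊆ Vᵢ exactly when its projection to Vᵢ does. So x ∈ Q^𝒯
-- depends only on x|V₁ ∈ Q₁^𝒯₁ and x|V₂ ∈ Q₂^𝒯₂; since V₁, V₂ and the rest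
-- are disjoint, any three such pieces glue to one word.
module Submission where

open import Defs
open import Level using (Level)
open import Data.Nat using (ℕ)
open import Data.Fin using (Fin)
open import Data.Fin.Subset using (Subset; _∪_; ∁; _∈_; _∉_; _⊆_)
open import Data.Fin.Subset.Properties using (_∈?_; x∈∁p⇒x∉p; x∉p⇒x∈∁p; x∈p∪q⁻; x∈p∪q⁺)
open import Data.Vec.Properties.WithK using ([]=-irrelevant)
open import Data.Product using (_×_; ∃-syntax; _,_; proj₁)
open import Data.Sum using (_⊎_; inj₁; inj₂; [_,_])
open import Data.Empty using (⊥-elim)
open import Function.Bundles using (_⇔_; mk⇔; Equivalence)
open import Function.Construct.Composition using (_⇔-∘_)
open import Data.Product.Function.NonDependent.Propositional using (_×-⇔_)
open import Relation.Nullary using (yes; no)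
open import Relation.Binary.PropositionalEquality using () renaming (refl to ≡-refl)

vertexSet-⊇-member : ∀ {ℓt n} {𝒯 : Subset n → Set ℓt} {V T : Subset n} →
                     IsVertexSet 𝒯 V → 𝒯 T → T ⊆ V
vertexSet-⊇-member {T = T} isV T∈𝒯 {i} i∈T = Equivalence.from (isV i) (T , T∈𝒯 , i∈T)

∉∪⇒∈∁∪ : ∀ {n} {V W : Subset n} {i : Fin n} → i ∉ V → i ∉ W → i ∈ ∁ (V ∪ W)
∉∪⇒∈∁∪ {V = V} {W} i∉V i∉W = x∉p⇒x∈∁p λ i∈V∪W → [ i∉V , i∉W ] (x∈p∪q⁻ V W i∈V∪W)

module _ {c ℓ : Level} (F : Field c ℓ) {n : ℕ} where
  open Field F

  coord-irrelevant : {V : Subset n} (z : WordOn F V) {i : Fin n} (a b : i ∈ V) →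
                     z (i , a) ≈ z (i , b)
  coord-irrelevant z a b with []=-irrelevant a b
  ... | ≡-refl = refl

  LiftOn-resp-≈V : ∀ {ℓp ℓt} {V : Subset n} {P : WordOn F V → Set ℓp}
                   {𝒯 : Subset n → Set ℓt} {z w : WordOn F V} →
                   _≈V_ F z w → LiftOn F V P 𝒯 z → LiftOn F V P 𝒯 w
  LiftOn-resp-≈V z≈w L T T∈𝒯 with L T T∈𝒯
  ... | u , Pu , z≈u = u , Pu , λ p i∈T → trans (sym (z≈w p)) (z≈u p i∈T)

  module _ (V₁ V₂ : Subset n) (z₁ : WordOn F V₁) (z₂ : WordOn F V₂)
           (z₃ : WordOn F (∁ (V₁ ∪ V₂))) where

    glue : Word F n
    glue i with i ∈? V₁
    ... | yes i∈V₁ = z₁ (i , i∈V₁)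
    ... | no i∉V₁ with i ∈? V₂
    ...   | yes i∈V₂ = z₂ (i , i∈V₂)
    ...   | no i∉V₂ = z₃ (i , ∉∪⇒∈∁∪ i∉V₁ i∉V₂)

    restrict-glue₁ : _≈V_ F (restrict F V₁ glue) z₁
    restrict-glue₁ (i , i∈V₁) with i ∈? V₁
    ... | yes i∈V₁′ = coord-irrelevant z₁ i∈V₁′ i∈V₁
    ... | no i∉V₁ = ⊥-elim (i∉V₁ i∈V₁)

    restrict-glue₂ : DisjointSub V₁ V₂ → _≈V_ F (restrict F V₂ glue) z₂
    restrict-glue₂ V₁∩V₂≡∅ (i , i∈V₂) with i ∈? V₁
    ... | yes i∈V₁ = ⊥-elim (V₁∩V₂≡∅ i i∈V₁ i∈V₂)
    ... | no _ with i ∈? V₂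
    ...   | yes i∈V₂′ = coord-irrelevant z₂ i∈V₂′ i∈V₂
    ...   | no i∉V₂ = ⊥-elim (i∉V₂ i∈V₂)

    restrict-glue₃ : _≈V_ F (restrict F (∁ (V₁ ∪ V₂)) glue) z₃
    restrict-glue₃ (i , i∈∁) with i ∈? V₁
    ... | yes i∈V₁ = ⊥-elim (x∈∁p⇒x∉p i∈∁ (x∈p∪q⁺ (inj₁ i∈V₁)))
    ... | no i∉V₁ with i ∈? V₂
    ...   | yes i∈V₂ = ⊥-elim (x∈∁p⇒x∉p i∈∁ (x∈p∪q⁺ (inj₂ i∈V₂)))
    ...   | no i∉V₂ = coord-irrelevant z₃ (∉∪⇒∈∁∪ i∉V₁ i∉V₂) i∈∁

  module _ {ℓq ℓt : Level} (Q : Word F n → Set ℓq) where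

    Lift-⊎ : {𝒯 𝒯₁ 𝒯₂ : Subset n → Set ℓt} → (∀ T → 𝒯 T ⇔ (𝒯₁ T ⊎ 𝒯₂ T)) →
             (x : Word F n) → Lift F Q 𝒯 x ⇔ (Lift F Q 𝒯₁ x × Lift F Q 𝒯₂ x)
    Lift-⊎ 𝒯≡𝒯₁⊎𝒯₂ x = mk⇔
      (λ L → (λ T T∈𝒯₁ → L T (Equivalence.from (𝒯≡𝒯₁⊎𝒯₂ T) (inj₁ T∈𝒯₁)))
           , (λ T T∈𝒯₂ → L T (Equivalence.from (𝒯≡𝒯₁⊎𝒯₂ T) (inj₂ T∈𝒯₂))))
      (λ { (L₁ , L₂) T T∈𝒯 → [ L₁ T , L₂ T ] (Equivalence.to (𝒯≡𝒯₁⊎𝒯₂ T) T∈𝒯) })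

    Lift⇔LiftOn-Proj : {𝒯 : Subset n → Set ℓt} (V : Subset n) → (∀ T → 𝒯 T → T ⊆ V) →
                       (x : Word F n) →
                       Lift F Q 𝒯 x ⇔ LiftOn F V (Proj F Q V) 𝒯 (restrict F V x)
    Lift⇔LiftOn-Proj {𝒯} V members⊆V x = mk⇔ to from
      where
      to : Lift F Q 𝒯 x → LiftOn F V (Proj F Q V) 𝒯 (restrict F V x)
      to L T T∈𝒯 with L T T∈𝒯
      ... | y , Qy , x≈y = restrict F V y , (y , Qy , λ _ → refl) , λ p → x≈y (proj₁ p)

      from : LiftOn F V (Proj F Q V) 𝒯 (restrict F V x) → Lift F Q 𝒯 x
      from L T T∈𝒯 with L T T∈𝒯
      ... | w , (y , Qy , w≈y) , x≈w = y , Qy , λ i i∈T →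
        let i∈V = members⊆V T T∈𝒯 i∈T in trans (x≈w (i , i∈V) i∈T) (w≈y (i , i∈V))

corollary1 : ∀ {c ℓ ℓq ℓt : Level} (F : Field c ℓ) (n : ℕ)
    (Q : Word F n → Set ℓq) → IsLinearCode F Q →
    (𝒯 𝒯₁ 𝒯₂ : Subset n → Set ℓt) →
    IsCollusionPattern 𝒯₁ → IsCollusionPattern 𝒯₂ →
    (∀ T → 𝒯 T ⇔ (𝒯₁ T ⊎ 𝒯₂ T)) →
    (V₁ V₂ : Subset n) → IsVertexSet 𝒯₁ V₁ → IsVertexSet 𝒯₂ V₂ →
    DisjointSub V₁ V₂ →
    -- x ↦ (x|V₁ , x|V₂ , x|rest) maps Q^𝒯 into the product ...
    ((x : Word F n) → Lift F Q 𝒯 x ⇔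
        (LiftOn F V₁ (Proj F Q V₁) 𝒯₁ (restrict F V₁ x)
          × LiftOn F V₂ (Proj F Q V₂) 𝒯₂ (restrict F V₂ x)))
    -- ... and onto it (with F^([n] ∖ (V₁ ∪ V₂)) as third factor)
    × ((z₁ : WordOn F V₁) (z₂ : WordOn F V₂) (z₃ : WordOn F (∁ (V₁ ∪ V₂))) →
        LiftOn F V₁ (Proj F Q V₁) 𝒯₁ z₁ →
        LiftOn F V₂ (Proj F Q V₂) 𝒯₂ z₂ →
        ∃[ x ] (Lift F Q 𝒯 x
          × _≈V_ F (restrict F V₁ x) z₁
          × _≈V_ F (restrict F V₂ x) z₂
          × _≈V_ F (restrict F (∁ (V₁ ∪ V₂)) x) z₃))
corollary1 F n Q _ 𝒯 𝒯₁ 𝒯₂ _ _ 𝒯≡𝒯₁⊎𝒯₂ V₁ V₂ isV₁ isV₂ V₁∩V₂≡∅ =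
  Lift⇔LiftOns , λ z₁ z₂ z₃ L₁ L₂ →
    let x = glue F V₁ V₂ z₁ z₂ z₃
        x|₁≈z₁ = restrict-glue₁ F V₁ V₂ z₁ z₂ z₃
        x|₂≈z₂ = restrict-glue₂ F V₁ V₂ z₁ z₂ z₃ V₁∩V₂≡∅
    in x
     , Equivalence.from (Lift⇔LiftOns x)
         ( LiftOn-resp-≈V F (λ p → sym (x|₁≈z₁ p)) L₁
         , LiftOn-resp-≈V F (λ p → sym (x|₂≈z₂ p)) L₂)
     , x|₁≈z₁ , x|₂≈z₂ , restrict-glue₃ F V₁ V₂ z₁ z₂ z₃
  where
  open Field F using (sym)

  Lift⇔LiftOns : (x : Word F n) → Lift F Q 𝒯 x ⇔
    (LiftOn F V₁ (Proj F Q V₁) 𝒯₁ (restrict F V₁ x)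
      × LiftOn F V₂ (Proj F Q V₂) 𝒯₂ (restrict F V₂ x))
  Lift⇔LiftOns x =
    (Lift⇔LiftOn-Proj F Q V₁ (λ _ → vertexSet-⊇-member isV₁) x
      ×-⇔ Lift⇔LiftOn-Proj F Q V₂ (λ _ → vertexSet-⊇-member isV₂) x)
    ⇔-∘ Lift-⊎ F Q 𝒯≡𝒯₁⊎𝒯₂ x
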